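{- If all vertex degrees in a graph $G$ are even and the complement $\bar G$ has an external bisection, then $G$ has an internal bisection.
   Context: Graphs are finite and simple; $\bar G$ is the complement of $G$. For $S\subseteq V$, $d_S(v)$ is the number of neighbors of $v$ in $S$ and $d(v)$ the degree (in the graph under consideration). A partition $(A,B)$ of $V$ with $A,B\ne\emptyset$ is internal if $d_A(x)\ge d(x)/2$ for all $x\in A$ and $d_B(x)\ge d(x)/2$ for all $x\in B$; it is external if $d_B(x)\ge d(x)/2$ for all $x\in A$ and $d_A(x)\ge d(x)/2$ for all $x\in B$. A bisection is a partition with $|A|=|B|$; an internal (external) bisection is an internal (external) partition that is a bisection. -}

module Defs where

open import Data.Nat using (ℕ; _+_; _*_; _≤_)
open import Data.Bool using (Bool; true; false; not; _∧_; if_then_else_)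
open import Data.Fin using (Fin; _≟_)
open import Data.Fin.Properties using ()
open import Data.List using (List; length; filter)
open import Data.List.Base using (allFin)
open import Data.Product using (Σ; ∃; _×_; _,_)
open import Relation.Binary.PropositionalEquality using (_≡_)
open import Relation.Nullary using (¬_; does)
open import Relation.Nullary.Decidable using (⌊_⌋)
open import Data.Bool using (T)

record Graph (n : ℕ) : Set where
  field
    adj   : Fin n → Fin n → Bool
    adj-sym : ∀ u v → adj u v ≡ adj v u
    adj-irrefl : ∀ v → adj v v ≡ false
open Graph public

Subset : ℕ → Set
Subset n = Fin n → Bool

compl : ∀ {n} → Subset n → Subset n
compl S v = not (S v)

size : ∀ {n} → Subset n → ℕ
size {n} S = length (filter (λ v → T? (S v)) (allFin n))
  where
  open import Data.Bool.Properties using (T?)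

degIn : ∀ {n} → Graph n → Subset n → Fin n → ℕ
degIn {n} G S v = size (λ u → adj G v u ∧ S u)

deg : ∀ {n} → Graph n → Fin n → ℕ
deg G v = degIn G (λ _ → true) v

complement : ∀ {n} → Graph n → Graph n
complement {n} G = record
  { adj = λ u v → not (adj G u v) ∧ not ⌊ u ≟ v ⌋
  ; adj-sym = symC
  ; adj-irrefl = irrC }
  where
  open import Relation.Binary.PropositionalEquality using (refl; cong) renaming (sym to ≡sym)
  open import Relation.Nullary using (yes; no)
  open import Data.Bool.Properties using (∧-zeroʳ)
  symC : ∀ u v → (not (adj G u v) ∧ not ⌊ u ≟ v ⌋) ≡ (not (adj G v u) ∧ not ⌊ v ≟ u ⌋)
  symC u v with u ≟ v | v ≟ u
  ... | yes _ | yes _ = cong (λ a → not a ∧ false) (adj-sym G u v)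
  ... | no _  | no _  = cong (λ a → not a ∧ true) (adj-sym G u v)
  ... | yes p | no ¬p = Relation.Nullary.contradiction (≡sym p) ¬p
  ... | no ¬p | yes p = Relation.Nullary.contradiction (≡sym p) ¬p
  irrC : ∀ v → (not (adj G v v) ∧ not ⌊ v ≟ v ⌋) ≡ false
  irrC v with v ≟ v
  ... | yes _ = ∧-zeroʳ _
  ... | no ¬p = Relation.Nullary.contradiction refl ¬p

Nonempty : ∀ {n} → Subset n → Set
Nonempty {n} S = ∃ λ v → S v ≡ true

IsPartition : ∀ {n} → Subset n → Set
IsPartition A = Nonempty A × Nonempty (compl A)

-- internal: d_A(x) ≥ d(x)/2 on A, d_B(x) ≥ d(x)/2 on B  (written d(x) ≤ 2·d_S(x))
IsInternal : ∀ {n} → Graph n → Subset n → Set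
IsInternal G A = IsPartition A
  × (∀ x → A x ≡ true  → deg G x ≤ 2 * degIn G A x)
  × (∀ x → A x ≡ false → deg G x ≤ 2 * degIn G (compl A) x)

IsExternal : ∀ {n} → Graph n → Subset n → Set
IsExternal G A = IsPartition A
  × (∀ x → A x ≡ true  → deg G x ≤ 2 * degIn G (compl A) x)
  × (∀ x → A x ≡ false → deg G x ≤ 2 * degIn G A x)

IsBisection : ∀ {n} → Subset n → Set
IsBisection A = size A ≡ size (compl A)

HasInternalBisection : ∀ {n} → Graph n → Set
HasInternalBisection G = ∃ λ A → IsInternal G A × IsBisection A

HasExternalBisection : ∀ {n} → Graph n → Set
HasExternalBisection G = ∃ λ A → IsExternal G A × IsBisection A

module Submission where

-- Let (A , B) be an external bisection of the complement Ḡ, and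
-- fix x ∈ A (the case x ∈ B is the same with the roles of A and B swapped).
-- Write a, b for the numbers of G-neighbours of x in A, B and ā, b̄ for the
-- Ḡ-neighbours.  Every vertex other than x is a neighbour of x in exactly one
-- of G and Ḡ, so  |A| = a + ā + 1  and  |B| = b + b̄.  As |A| = |B| and the
-- external condition says ā ≤ b̄, we get b ≤ a + 1; since a + b = d(x) is
-- even, b ≠ a + 1, hence b ≤ a, i.e. d(x) ≤ 2·d_A(x).  So the same A is an
-- internal bisection of G.

open import Defs
open import Data.Nat using (ℕ)
open import Data.Nat.Divisibility using (_∣_)

open import Data.Nat using (zero; suc; _+_; _*_; _≤_; s≤s)
open import Data.Nat.Properties
  using (+-assoc; +-comm; *-comm; +-identityʳ; +-suc; +-cancelʳ-≤; +-monoʳ-≤;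
         m≤n⇒m<n∨m≡n; even≢odd; module ≤-Reasoning)
open import Data.Nat.Divisibility using (divides)
open import Data.Bool using (Bool; true; false; not; _∧_)
open import Data.Bool.Properties using (T?; not-involutive)
open import Data.Fin using (Fin; _≟_)
import Data.Fin as Fin
open import Data.List using (length; filter; tabulate)
open import Data.Product using (_,_)
open import Data.Sum using (inj₁; inj₂)
open import Function using (_∘_; id)
open import Relation.Binary.PropositionalEquality
open import Relation.Nullary using (yes; no; contradiction)
open import Relation.Nullary.Decidable using (⌊_⌋)

indicator : Bool → ℕ
indicator true  = 1
indicator false = 0

-- count n f = Σ_{u : Fin n} [f u]; a recursion-friendly form of `size`.
count : (n : ℕ) → (Fin n → Bool) → ℕ
count zero    f = 0
count (suc n) f = indicator (f Fin.zero) + count n (f ∘ Fin.suc)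

-- Filtering a tabulated list counts the true entries; generalised over the
-- tabulating function so that the induction goes through `allFin = tabulate id`.
length-filter-tabulate : ∀ n {m} (h : Fin n → Fin m) (g : Fin m → Bool) →
  length (filter (λ v → T? (g v)) (tabulate h)) ≡ count n (g ∘ h)
length-filter-tabulate zero    h g = refl
length-filter-tabulate (suc n) h g with g (h Fin.zero)
... | true  = cong suc (length-filter-tabulate n (h ∘ Fin.suc) g)
... | false = length-filter-tabulate n (h ∘ Fin.suc) g

size≡count : ∀ {n} (S : Subset n) → size S ≡ count n S
size≡count {n} S = length-filter-tabulate n id S

count-cong : ∀ n {f g : Fin n → Bool} → (∀ u → f u ≡ g u) → count n f ≡ count n g
count-cong zero    e = refl
count-cong (suc n) e = cong₂ _+_ (cong indicator (e Fin.zero)) (count-cong n (e ∘ Fin.suc))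

count-split : ∀ n (f g h : Fin n → Bool) →
  (∀ u → indicator (f u) ≡ indicator (g u) + indicator (h u)) →
  count n f ≡ count n g + count n h
count-split zero    f g h e = refl
count-split (suc n) f g h e = begin
  indicator (f Fin.zero) + count n (f ∘ Fin.suc)
    ≡⟨ cong₂ _+_ (e Fin.zero) (count-split n _ _ _ (e ∘ Fin.suc)) ⟩
  (x + y) + (X + Y) ≡⟨ interchange x y X Y ⟩
  (x + X) + (y + Y) ∎
  where
  open ≡-Reasoning
  x = indicator (g Fin.zero)
  y = indicator (h Fin.zero)
  X = count n (g ∘ Fin.suc)
  Y = count n (h ∘ Fin.suc)
  interchange : ∀ a b c d → (a + b) + (c + d) ≡ (a + c) + (b + d)
  interchange a b c d = begin
    (a + b) + (c + d) ≡⟨ +-assoc a b (c + d) ⟩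
    a + (b + (c + d)) ≡⟨ cong (a +_) (sym (+-assoc b c d)) ⟩
    a + ((b + c) + d) ≡⟨ cong (λ t → a + (t + d)) (+-comm b c) ⟩
    a + ((c + b) + d) ≡⟨ cong (a +_) (+-assoc c b d) ⟩
    a + (c + (b + d)) ≡⟨ sym (+-assoc a c (b + d)) ⟩
    (a + c) + (b + d) ∎

count-false : ∀ n → count n (λ _ → false) ≡ 0
count-false zero    = refl
count-false (suc n) = count-false n

suc-≟ : ∀ {n} (x u : Fin n) → ⌊ Fin.suc x ≟ Fin.suc u ⌋ ≡ ⌊ x ≟ u ⌋
suc-≟ x u with x ≟ u
... | yes _ = refl
... | no  _ = refl

count-point : ∀ n (x : Fin n) (f : Fin n → Bool) →
  count n (λ u → ⌊ x ≟ u ⌋ ∧ f u) ≡ indicator (f x)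
count-point (suc n) Fin.zero    f =
  trans (cong (indicator (f Fin.zero) +_) (count-false n)) (+-identityʳ _)
count-point (suc n) (Fin.suc x) f =
  trans (count-cong n (λ u → cong (_∧ f (Fin.suc u)) (suc-≟ x u)))
        (count-point n x (f ∘ Fin.suc))

split-by-subset : ∀ a s → indicator (a ∧ true) ≡ indicator (a ∧ s) + indicator (a ∧ not s)
split-by-subset true  true  = refl
split-by-subset true  false = refl
split-by-subset false _     = refl

split-by-adjacency : ∀ a s → indicator s ≡ indicator (a ∧ s) + indicator (not a ∧ s)
split-by-adjacency true  s = sym (+-identityʳ (indicator s))
split-by-adjacency false s = refl

split-non-neighbour : ∀ {n} (G : Graph n) (S : Subset n) x u →
  indicator (not (adj G x u) ∧ S u)
    ≡ indicator (adj (complement G) x u ∧ S u) + indicator (⌊ x ≟ u ⌋ ∧ S u)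
split-non-neighbour G S x u with x ≟ u
... | yes refl rewrite adj-irrefl G x with S x
...   | true  = refl
...   | false = refl
split-non-neighbour G S x u | no _ with adj G x u | S u
... | true  | _     = refl
... | false | true  = refl
... | false | false = refl

deg-split : ∀ {n} (G : Graph n) (S : Subset n) x →
  deg G x ≡ degIn G S x + degIn G (compl S) x
deg-split {n} G S x
  rewrite size≡count (λ u → adj G x u ∧ true) | size≡count (λ u → adj G x u ∧ S u)
        | size≡count (λ u → adj G x u ∧ not (S u))
  = count-split n _ _ _ (λ u → split-by-subset (adj G x u) (S u))

-- Every vertex of S is x or a neighbour of x in exactly one of G and Ḡ:
-- |S| = d_S(x) + d̄_S(x) + [x ∈ S].
size-around : ∀ {n} (G : Graph n) (S : Subset n) x →
  size S ≡ degIn G S x + degIn (complement G) S x + indicator (S x)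
size-around {n} G S x
  rewrite size≡count S | size≡count (λ u → adj G x u ∧ S u)
        | size≡count (λ u → adj (complement G) x u ∧ S u)
        | sym (count-point n x S)
  = begin
    count n S
      ≡⟨ count-split n _ _ _ (λ u → split-by-adjacency (adj G x u) (S u)) ⟩
    a + count n (λ u → not (adj G x u) ∧ S u)
      ≡⟨ cong (a +_) (count-split n _ _ _ (split-non-neighbour G S x)) ⟩
    a + (ā + p)
      ≡⟨ sym (+-assoc a ā p) ⟩
    a + ā + p ∎
  where
  open ≡-Reasoning
  a = count n (λ u → adj G x u ∧ S u)
  ā = count n (λ u → adj (complement G) x u ∧ S u)
  p = count n (λ u → ⌊ x ≟ u ⌋ ∧ S u)

size-cong : ∀ {n} {S T : Subset n} → (∀ u → S u ≡ T u) → size S ≡ size T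
size-cong {n} {S} {T} e = begin
  size S    ≡⟨ size≡count S ⟩
  count n S ≡⟨ count-cong n e ⟩
  count n T ≡⟨ size≡count T ⟨
  size T    ∎
  where open ≡-Reasoning

compl-compl : ∀ {n} (S : Subset n) u → compl (compl S) u ≡ S u
compl-compl S u = not-involutive (S u)

degIn-compl-compl : ∀ {n} (G : Graph n) (S : Subset n) x →
  degIn G (compl (compl S)) x ≡ degIn G S x
degIn-compl-compl G S x = size-cong (λ u → cong (adj G x u ∧_) (compl-compl S u))

at-most-half : ∀ m n → m + n ≤ 2 * n → m ≤ n
at-most-half m n le = +-cancelʳ-≤ n m n (subst (m + n ≤_) (cong (n +_) (+-identityʳ n)) le)

at-least-half : ∀ m n → n ≤ m → m + n ≤ 2 * m
at-least-half m n le = subst (m + n ≤_) (cong (m +_) (sym (+-identityʳ m))) (+-monoʳ-≤ m le)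

-- The heart of the argument.  If a + ā + 1 = b + b̄ with ā ≤ b̄, then b ≤ a + 1;
-- if moreover a + b is even then b ≠ a + 1, so b ≤ a.
even-majority : ∀ a b ā b̄ → a + ā + 1 ≡ b + b̄ → ā ≤ b̄ → 2 ∣ a + b → b ≤ a
even-majority a b ā b̄ sizes ā≤b̄ even with m≤n⇒m<n∨m≡n b≤1+a
  where
  open ≤-Reasoning
  b≤1+a : b ≤ suc a
  b≤1+a = +-cancelʳ-≤ b̄ b (suc a) (begin
    b + b̄          ≡⟨ sizes ⟨
    a + ā + 1      ≡⟨ +-assoc a ā 1 ⟩
    a + (ā + 1)    ≡⟨ cong (a +_) (+-comm ā 1) ⟩
    a + suc ā      ≡⟨ +-suc a ā ⟩
    suc a + ā      ≤⟨ +-monoʳ-≤ (suc a) ā≤b̄ ⟩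
    suc a + b̄      ∎)
... | inj₁ (s≤s b≤a) = b≤a
... | inj₂ refl with even
...   | divides q a+suc-a≡q*2 = contradiction (begin-equality
    2 * q          ≡⟨ *-comm 2 q ⟩
    q * 2          ≡⟨ a+suc-a≡q*2 ⟨
    a + suc a      ≡⟨ +-suc a a ⟩
    suc (a + a)    ≡⟨ cong (λ t → suc (a + t)) (+-identityʳ a) ⟨
    suc (2 * a)    ∎) (even≢odd q a)
  where open ≤-Reasoning

internal-at : ∀ {n} (G : Graph n) (S : Subset n) x → S x ≡ true →
  size S ≡ size (compl S) →
  deg (complement G) x ≤ 2 * degIn (complement G) (compl S) x →
  2 ∣ deg G x →
  deg G x ≤ 2 * degIn G S x
internal-at G S x x∈S bisection external even =
  subst (_≤ 2 * a) (sym (deg-split G S x)) (at-least-half a b b≤a)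
  where
  Ḡ = complement G
  a = degIn G S x
  b = degIn G (compl S) x
  ā = degIn Ḡ S x
  b̄ = degIn Ḡ (compl S) x
  sizes : a + ā + 1 ≡ b + b̄
  sizes = begin
    a + ā + 1                      ≡⟨ cong (λ s → a + ā + indicator s) x∈S ⟨
    a + ā + indicator (S x)        ≡⟨ size-around G S x ⟨
    size S                         ≡⟨ bisection ⟩
    size (compl S)                 ≡⟨ size-around G (compl S) x ⟩
    b + b̄ + indicator (not (S x)) ≡⟨ cong (λ s → b + b̄ + indicator (not s)) x∈S ⟩
    b + b̄ + 0                     ≡⟨ +-identityʳ (b + b̄) ⟩
    b + b̄                         ∎
    where open ≡-Reasoning
  ā≤b̄ : ā ≤ b̄
  ā≤b̄ = at-most-half ā b̄ (subst (_≤ 2 * b̄) (deg-split Ḡ S x) external)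
  b≤a : b ≤ a
  b≤a = even-majority a b ā b̄ sizes ā≤b̄ (subst (2 ∣_) (deg-split G S x) even)

-- The side B is handled by applying
-- `internal-at` to compl A, whose complement is A up to pointwise equality.
corollary3 : (n : ℕ) (G : Graph n) →
    (∀ v → 2 ∣ deg G v) →
    HasExternalBisection (complement G) →
    HasInternalBisection G
corollary3 n G even (A , (partition , external-A , external-B) , bisection) =
  A , (partition , internal-A , internal-B) , bisection
  where
  Ḡ = complement G
  internal-A : ∀ x → A x ≡ true → deg G x ≤ 2 * degIn G A x
  internal-A x x∈A = internal-at G A x x∈A bisection (external-A x x∈A) (even x)
  internal-B : ∀ x → A x ≡ false → deg G x ≤ 2 * degIn G (compl A) x
  internal-B x x∈B = internal-at G (compl A) x (cong not x∈B)
    (trans (sym bisection) (sym (size-cong (compl-compl A))))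
    (subst (λ d → deg Ḡ x ≤ 2 * d) (sym (degIn-compl-compl Ḡ A x)) (external-B x x∈B))
    (even x)
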